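{- Let $n,k,r$ be positive integers with $n>2k$ and $r\geq 2$. Let $H$ be an $n$-vertex $k$-graph with an edge-coloring $c:E(H)\to\{C_1,\dots,C_r\}$, and assume $H$ contains no good gadget of the first, second or third kind. Let $u,v$ be distinct vertices with $|N_H(u)\cap N_H(v)|>\binom{n-2}{k-1}-\binom{(n-2)-(k-1)}{k-1}+1$. Then either $uTv$ is $\mathbf S$ for all $T\in N_H(u)\cap N_H(v)$, or there exist $i\neq j$ such that $uTv$ is $\mathbf{C_iC_j}$ for all $T\in N_H(u)\cap N_H(v)$.
   Context: A $k$-graph is a hypergraph whose edges are $k$-element vertex sets. For a vertex $x$, $N_H(x)$ is the family of $(k-1)$-sets $S\subseteq V(H)\setminus\{x\}$ with $S\cup\{x\}\in E(H)$; $uT$ denotes $T\cup\{u\}$. For distinct $u,v$ and $T\in N_H(u)\cap N_H(v)$: $uTv$ is $\mathbf S$ if $c(uT)=c(vT)$, and $uTv$ is $\mathbf{C_iC_j}$ ($i\neq j$) if $c(uT)=C_i$ and $c(vT)=C_j$. The color profile of a set of edges is the vector whose $i$-th entry is the number of its edges colored $C_i$. Good gadgets (w.r.t. $c$): First kind: distinct vertices $u,v$ and disjoint $T_1,T_2\in N_H(u)\cap N_H(v)$ such that $\{T_1u,T_2v\}$ and $\{T_1v,T_2u\}$ have different color profiles. Second kind: distinct vertices $u_1,u_2,u_3$ and pairwise disjoint $T_1\in N_H(u_2)\cap N_H(u_3)$, $T_2\in N_H(u_1)\cap N_H(u_3)$, $T_3\in N_H(u_1)\cap N_H(u_2)$ such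 that $\{T_1u_2,T_2u_3,T_3u_1\}$ and $\{T_1u_3,T_2u_1,T_3u_2\}$ have different color profiles. Third kind: edges $e,f$ with $V(e)\setminus V(f)=\{u_1,\dots,u_\ell\}$, $V(f)\setminus V(e)=\{v_1,\dots,v_\ell\}$ for some $1\leq\ell\leq k$, and pairwise disjoint $T_i\in N_H(u_i)\cap N_H(v_i)$, disjoint from $V(e)\cup V(f)$, such that $\{u_1T_1,\dots,u_\ell T_\ell,f\}$ and $\{v_1T_1,\dots,v_\ell T_\ell,e\}$ have different color profiles. -}

module Defs where

open import Data.Nat using (ℕ; zero; suc; _+_; _∸_; _≤_; _<_; _>_)
open import Data.Nat.Combinatorics using (_C_)
open import Data.Bool using (Bool; true; false; not; _∧_)
open import Data.Fin using (Fin) renaming (_≟_ to _≟ᶠ_)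
open import Data.Fin.Subset using (Subset; _∈_; _∉_; _∪_; _─_; ⁅_⁆; ∣_∣)
open import Data.Vec using (_∷_; []; lookup)
open import Data.List using (List; []; _∷_; map; _++_; length; filter; [_])
open import Data.Product using (Σ; _×_; _,_; ∃; ∃-syntax)
open import Relation.Binary.PropositionalEquality using (_≡_; _≢_)
open import Relation.Nullary using (¬_)
open import Function.Definitions using (Injective)

allSubsets : (n : ℕ) → List (Subset n)
allSubsets zero = [] ∷ []
allSubsets (suc n) = map (true ∷_) (allSubsets n) ++ map (false ∷_) (allSubsets n)

record KGraph (n k : ℕ) : Set where
  field
    isEdge  : Subset n → Bool
    uniform : ∀ e → isEdge e ≡ true → ∣ e ∣ ≡ k
open KGraph public

Edge : ∀ {n k} → KGraph n k → Subset n → Set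
Edge H e = isEdge H e ≡ true

_·_ : ∀ {n} → Fin n → Subset n → Subset n
u · T = T ∪ ⁅ u ⁆

inNᵇ : ∀ {n k} → KGraph n k → Fin n → Subset n → Bool
inNᵇ H x T = not (lookup T x) ∧ isEdge H (x · T)

InN : ∀ {n k} → KGraph n k → Fin n → Subset n → Set
InN H x T = inNᵇ H x T ≡ true

InCommon : ∀ {n k} → KGraph n k → Fin n → Fin n → Subset n → Set
InCommon H u v T = InN H u T × InN H v T

commonSize : ∀ {n k} → KGraph n k → Fin n → Fin n → ℕ
commonSize {n} H u v =
  length (filter (λ T → inNᵇ H u T ∧ inNᵇ H v T Data.Bool.≟ true) (allSubsets n))

Disjoint : ∀ {n} → Subset n → Subset n → Set
Disjoint A B = ∀ x → x ∈ A → x ∉ B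

profile : ∀ {n r} → (Subset n → Fin r) → List (Subset n) → Fin r → ℕ
profile c es i = length (filter (λ e → c e ≟ᶠ i) es)

DiffProfile : ∀ {n r} → (Subset n → Fin r) → List (Subset n) → List (Subset n) → Set
DiffProfile c es fs = ¬ (∀ i → profile c es i ≡ profile c fs i)

tab : ∀ {A : Set} ℓ → (Fin ℓ → A) → List A
tab zero g = []
tab (suc ℓ) g = g Fin.zero ∷ tab ℓ (λ i → g (Fin.suc i))

GoodGadget1 : ∀ {n k r} → KGraph n k → (Subset n → Fin r) → Set
GoodGadget1 {n} H c =
  Σ (Fin n) λ u → Σ (Fin n) λ v → Σ (Subset n) λ T₁ → Σ (Subset n) λ T₂ →
    u ≢ v × InCommon H u v T₁ × InCommon H u v T₂ × Disjoint T₁ T₂ ×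
    DiffProfile c ((u · T₁) ∷ (v · T₂) ∷ []) ((v · T₁) ∷ (u · T₂) ∷ [])

GoodGadget2 : ∀ {n k r} → KGraph n k → (Subset n → Fin r) → Set
GoodGadget2 {n} H c =
  Σ (Fin n) λ u₁ → Σ (Fin n) λ u₂ → Σ (Fin n) λ u₃ →
  Σ (Subset n) λ T₁ → Σ (Subset n) λ T₂ → Σ (Subset n) λ T₃ →
    u₁ ≢ u₂ × u₁ ≢ u₃ × u₂ ≢ u₃ ×
    InCommon H u₂ u₃ T₁ × InCommon H u₁ u₃ T₂ × InCommon H u₁ u₂ T₃ ×
    Disjoint T₁ T₂ × Disjoint T₁ T₃ × Disjoint T₂ T₃ ×
    DiffProfile c ((u₂ · T₁) ∷ (u₃ · T₂) ∷ (u₁ · T₃) ∷ [])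
                  ((u₃ · T₁) ∷ (u₁ · T₂) ∷ (u₂ · T₃) ∷ [])

GoodGadget3 : ∀ {n k r} → KGraph n k → (Subset n → Fin r) → Set
GoodGadget3 {n} {k} H c =
  Σ (Subset n) λ e → Σ (Subset n) λ f → Σ ℕ λ ℓ →
  Σ (Fin ℓ → Fin n) λ u → Σ (Fin ℓ → Fin n) λ v → Σ (Fin ℓ → Subset n) λ T →
    Edge H e × Edge H f × 1 ≤ ℓ × ℓ ≤ k ×
    Injective _≡_ _≡_ u × Injective _≡_ _≡_ v ×
    (∀ x → x ∈ (e ─ f) → ∃[ i ] u i ≡ x) × (∀ i → u i ∈ (e ─ f)) ×
    (∀ x → x ∈ (f ─ e) → ∃[ i ] v i ≡ x) × (∀ i → v i ∈ (f ─ e)) ×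
    (∀ i → InCommon H (u i) (v i) (T i)) ×
    (∀ i j → i ≢ j → Disjoint (T i) (T j)) ×
    (∀ i → Disjoint (T i) (e ∪ f)) ×
    DiffProfile c (tab ℓ (λ i → u i · T i) ++ [ f ])
                  (tab ℓ (λ i → v i · T i) ++ [ e ])

NoGoodGadget : ∀ {n k r} → KGraph n k → (Subset n → Fin r) → Set
NoGoodGadget H c = ¬ GoodGadget1 H c × ¬ GoodGadget2 H c × ¬ GoodGadget3 H c

-- For T in N(u) ∩ N(v) look at the pair of colours (c(uT), c(vT)). If T and T′ are disjoint,
-- the absence of a good gadget of the first kind says that {c(uT), c(vT′)} and {c(vT), c(uT′)}
-- are equal multisets, which forces the pairs of T and T′ to have the same pattern: both
-- monochromatic, or equal. Fix one T₀ and delete u and v: the sets with the pattern of T₀ and the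
-- remaining sets form two (k−1)-uniform cross-intersecting families on n − 2 points. If both were
-- nonempty, the Hilton–Milner bound |A| + |B| ≤ C(n−2,k−1) − C(n−k−1,k−1) + 1 for nonempty
-- cross-intersecting families would contradict the size of N(u) ∩ N(v).
--
-- The Hilton–Milner bound is proved by induction on the number m of points. For m = 2s the
-- complements of the sets in A avoid B. Otherwise both families are first compressed until they
-- are stable; then the sets avoiding the first point form a smaller instance, the links of the
-- first point are again cross-intersecting, and Pascal's rule combines the two bounds.

module Submission where

open import Defs
open import Data.Nat using (ℕ; zero; suc; _+_; _*_; _∸_; _≤_; _<_; _>_; z≤n; s≤s)
open import Data.Nat.Properties
open import Algebra.Properties.CommutativeSemigroup +-commutativeSemigroup using (interchange)
open import Data.Nat.Combinatorics using (_C_; nCn≡1; nCk+nC[k+1]≡[n+1]C[k+1])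
open import Data.Bool as Bool using (Bool; true; not; _∧_; if_then_else_)
open import Data.Bool.Properties using (not-injective; ∧-conicalˡ; ∧-conicalʳ)
open import Data.Fin using (Fin; zero; suc; punchOut)
open import Data.Fin.Subset using (Subset; _∈_; _∉_; _-_; ⁅_⁆; ∣_∣; ∁; _⊆_; inside; outside)
open import Data.Fin.Subset.Properties
  using (_∈?_; x∈p∪q⁺; x∈p∪q⁻; x∈⁅x⁆; x∈⁅y⁆⇒x≡y; ⊆-antisym; ∪-identityʳ; drop-there; x∈p⇒∣p-x∣<∣p∣;
         ∣∁p∣≡n∸∣p∣; x∈p⇒x∉∁p; ∣p∣≤n; ∣p∣≤∣x∷p∣)
open import Data.Vec using (_∷_; []; here; there; lookup; insertAt; removeAt)
open import Data.Vec.Properties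
  using (∷-injectiveˡ; ∷-injectiveʳ; ≡-dec; []=⇒lookup; insertAt-removeAt; removeAt-punchOut)
open import Data.List using (List; []; _∷_; length; map; _++_; filter)
open import Data.List.Properties using (length-map; length-++)
open import Data.List.Relation.Unary.Any using (here; there; any?)
open import Data.List.Relation.Unary.All as All using ([]; _∷_)
open import Data.List.Relation.Unary.All.Properties using (¬Any⇒All¬; All¬⇒¬Any) renaming (map⁺ to All-map⁺)
open import Data.List.Relation.Unary.Unique.Propositional using (Unique; []; _∷_)
import Data.List.Relation.Unary.Unique.Propositional.Properties as Unique
open import Data.List.Membership.Propositional using (find; lose) renaming (_∈_ to _∈ₗ_; _∉_ to _∉ₗ_)
open import Data.List.Membership.Propositional.Properties
  using (∈-map⁺; ∈-map⁻; ∈-++⁻; ∈-++⁺ˡ; ∈-++⁺ʳ; ∈-filter⁺; ∈-filter⁻)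
open import Data.Product as Product using (Σ; _×_; _,_; ∃; ∃₂; ∃-syntax; proj₁; proj₂)
open import Data.Sum as Sum using (_⊎_; inj₁; inj₂)
open import Relation.Binary.PropositionalEquality
open import Relation.Nullary using (¬_; Dec; yes; no; does; contradiction; ¬?)
open import Relation.Nullary.Decidable using (_→-dec_; _×-dec_; _⊎-dec_; decidable-stable)
open import Function using (_∘_)
open import Data.Unit using (⊤; tt)
open import Induction.WellFounded using (Acc; acc)
open import Data.Nat.Induction using (<-wellFounded)
import Data.Fin.Properties as Fin

private
  variable
    m s t : ℕ
    x j : Fin m
    S T : Subset m

+-interchange-≤ : ∀ a b c d {p q} → a + c ≤ p → b + d ≤ q → (a + b) + (c + d) ≤ p + q
+-interchange-≤ a b c d {p} {q} ac≤p bd≤q = subst (_≤ p + q) (interchange a c b d) (+-mono-≤ ac≤p bd≤q)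

[1+t]+[1+t]≤m⇒t+t<m : ∀ t {m} → suc t + suc t ≤ m → t + t < m
[1+t]+[1+t]≤m⇒t+t<m t = <-≤-trans (s≤s (+-monoʳ-≤ t (n≤1+n t)))

[1+t]+[1+t]≤m⇒t<m : ∀ t {m} → suc t + suc t ≤ m → t < m
[1+t]+[1+t]≤m⇒t<m t = <-≤-trans (s≤s (m≤m+n t (suc t)))

ℓ+[a+b]≤c+1⇒ℓ+b≤c : ∀ ℓ a b c → 0 < a → ℓ + (a + b) ≤ c + 1 → ℓ + b ≤ c
ℓ+[a+b]≤c+1⇒ℓ+b≤c ℓ a b c 0<a ℓ+a+b≤c+1 = +-cancelʳ-≤ 1 (ℓ + b) c (begin
  ℓ + b + 1    ≡⟨ +-assoc ℓ b 1 ⟩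
  ℓ + (b + 1)  ≤⟨ +-monoʳ-≤ ℓ (+-monoʳ-≤ b 0<a) ⟩
  ℓ + (b + a)  ≡⟨ cong (ℓ +_) (+-comm b a) ⟩
  ℓ + (a + b)  ≤⟨ ℓ+a+b≤c+1 ⟩
  c + 1        ∎)
  where open ≤-Reasoning

+-interchange₃ : ∀ a₁ a₀ b₁ b₀ c₁ c₀ →
                 (a₁ + a₀) + (b₁ + b₀) + (c₁ + c₀) ≡ (a₁ + b₁ + c₁) + (a₀ + b₀ + c₀)
+-interchange₃ a₁ a₀ b₁ b₀ c₁ c₀ =
  trans (cong (_+ (c₁ + c₀)) (interchange a₁ a₀ b₁ b₀)) (interchange (a₁ + b₁) (a₀ + b₀) c₁ c₀)

y∸x+1<ℓ⇒ℓ+x≰y+1 : ∀ {ℓ x y} → y ∸ x + 1 < ℓ → ¬ (ℓ + x ≤ y + 1)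
y∸x+1<ℓ⇒ℓ+x≰y+1 {ℓ} {x} {y} y∸x+1<ℓ ℓ+x≤y+1 = <-irrefl refl (begin-strict
  y + 1             ≤⟨ +-monoˡ-≤ 1 (m≤n+m∸n y x) ⟩
  x + (y ∸ x) + 1   ≡⟨ +-assoc x (y ∸ x) 1 ⟩
  x + (y ∸ x + 1)   <⟨ +-monoʳ-< x y∸x+1<ℓ ⟩
  x + ℓ             ≡⟨ +-comm x ℓ ⟩
  ℓ + x             ≤⟨ ℓ+x≤y+1 ⟩
  y + 1             ∎)
  where open ≤-Reasoning

k≤n⇒0<nCk : ∀ {n k} → k ≤ n → 0 < n C k
k≤n⇒0<nCk {k = zero} _ = s≤s z≤n
k≤n⇒0<nCk {suc n} {suc k} (s≤s k≤n) =
  subst (0 <_) (nCk+nC[k+1]≡[n+1]C[k+1] n k) (≤-trans (k≤n⇒0<nCk k≤n) (m≤m+n (n C k) (n C suc k)))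

2[1+k]<2+m⇒k+k≤m : ∀ k m → 2 * suc k < suc (suc m) → k + k ≤ m
2[1+k]<2+m⇒k+k≤m k m (s≤s (s≤s k+[1+k+0]≤m)) =
  ≤-trans (+-monoʳ-≤ k (≤-trans (n≤1+n k) (≤-reflexive (sym (+-identityʳ (suc k)))))) k+[1+k+0]≤m

length-≡0 : ∀ {A : Set} {xs : List A} → (∀ {x} → x ∉ₗ xs) → length xs ≡ 0
length-≡0 {xs = []} _ = refl
length-≡0 {xs = x ∷ xs} ∉xs = contradiction (here refl) ∉xs

empty-or-member : ∀ {A : Set} (xs : List A) → xs ≡ [] ⊎ ∃ (_∈ₗ xs)
empty-or-member [] = inj₁ refl
empty-or-member (x ∷ _) = inj₂ (x , here refl)

member-of-length : ∀ {A : Set} {xs : List A} → 0 < length xs → ∃ (_∈ₗ xs)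
member-of-length {xs = x ∷ _} _ = x , here refl

unique-map-on : ∀ {A B : Set} {f : A → B} {xs : List A} →
                (∀ {x y} → x ∈ₗ xs → y ∈ₗ xs → f x ≡ f y → x ≡ y) → Unique xs → Unique (map f xs)
unique-map-on {xs = []} _ [] = []
unique-map-on {xs = x ∷ xs} f-inj (x∉xs ∷ xs!) =
  All-map⁺ (All.tabulate λ y∈xs fx≡fy → All.lookup x∉xs y∈xs (f-inj (here refl) (there y∈xs) fx≡fy))
  ∷ unique-map-on (λ x∈ y∈ → f-inj (there x∈) (there y∈)) xs!

length-partition : ∀ {A : Set} {P : A → Set} (P? : (x : A) → Dec (P x)) (xs : List A) →
                   length xs ≡ length (filter P? xs) + length (filter (λ x → ¬? (P? x)) xs)
length-partition P? [] = refl
length-partition P? (x ∷ xs) with P? x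
... | yes _ = cong suc (length-partition P? xs)
... | no _ = trans (cong suc (length-partition P? xs)) (sym (+-suc _ _))

Intersects : Subset m → Subset m → Set
Intersects S T = ∃[ x ] x ∈ S × x ∈ T

intersects? : (S T : Subset m) → Dec (Intersects S T)
intersects? S T = Fin.any? λ x → x ∈? S ×-dec x ∈? T

intersects-sym : Intersects S T → Intersects T S
intersects-sym (x , x∈S , x∈T) = x , x∈T , x∈S

¬intersects⇒disjoint : ¬ Intersects S T → Disjoint S T
¬intersects⇒disjoint ¬S∩T x x∈S x∈T = ¬S∩T (x , x∈S , x∈T)

intersects⇒nonzero : Intersects S T → ∣ S ∣ ≢ 0
intersects⇒nonzero {S = S} (x , x∈S , _) ∣S∣≡0 =
  n≮0 (subst (∣ S - x ∣ <_) ∣S∣≡0 (x∈p⇒∣p-x∣<∣p∣ x∈S))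

intersects-dropˡ : ∀ {c} → Intersects (outside ∷ S) (c ∷ T) → Intersects S T
intersects-dropˡ (suc x , there x∈S , x∈cT) = x , x∈S , drop-there x∈cT

intersects-dropʳ : ∀ {b} → Intersects (b ∷ S) (outside ∷ T) → Intersects S T
intersects-dropʳ = intersects-sym ∘ intersects-dropˡ ∘ intersects-sym

∈-·⁺ : x ∈ S → x ∈ j · S
∈-·⁺ x∈S = x∈p∪q⁺ (inj₁ x∈S)

∈-·-self : j ∈ j · S
∈-·-self {j = j} = x∈p∪q⁺ (inj₂ (x∈⁅x⁆ j))

∈-·⁻ : x ∈ j · S → x ≢ j → x ∈ S
∈-·⁻ {j = j} {S = S} x∈jS x≢j with x∈p∪q⁻ S ⁅ j ⁆ x∈jS
... | inj₁ x∈S = x∈S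
... | inj₂ x∈⁅j⁆ = contradiction (x∈⁅y⁆⇒x≡y j x∈⁅j⁆) x≢j

∣·∣ : j ∉ S → ∣ j · S ∣ ≡ suc ∣ S ∣
∣·∣ {j = zero} {S = outside ∷ S} _ = cong (λ U → suc ∣ U ∣) (∪-identityʳ S)
∣·∣ {j = zero} {S = inside ∷ S} j∉S = contradiction here j∉S
∣·∣ {j = suc j} {S = inside ∷ S} j∉S = cong suc (∣·∣ (λ j∈S → j∉S (there j∈S)))
∣·∣ {j = suc j} {S = outside ∷ S} j∉S = ∣·∣ (λ j∈S → j∉S (there j∈S))

·-injective : j ∉ S → j ∉ T → j · S ≡ j · T → S ≡ T
·-injective {j = j} j∉S j∉T eq = ⊆-antisym (transfer j∉S eq) (transfer j∉T (sym eq))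
  where
  transfer : ∀ {S T} → j ∉ S → j · S ≡ j · T → S ⊆ T
  transfer j∉S eq x∈S = ∈-·⁻ (subst (_ ∈_) eq (∈-·⁺ x∈S)) λ { refl → j∉S x∈S }

free-element : {S : Subset m} → ∣ S ∣ < m → ∃ (_∉ S)
free-element {S = []} ()
free-element {S = outside ∷ S} _ = zero , λ ()
free-element {S = inside ∷ S} (s≤s ∣S∣<m) with free-element ∣S∣<m
... | x , x∉S = suc x , x∉S ∘ drop-there

free-common-element : {S T : Subset m} → ∣ S ∣ + ∣ T ∣ < m → ∃[ x ] x ∉ S × x ∉ T
free-common-element {S = []} {[]} ()
free-common-element {S = outside ∷ S} {outside ∷ T} _ = zero , (λ ()) , (λ ())
free-common-element {S = inside ∷ S} {c ∷ T} (s≤s ∣S∣+∣cT∣<m) =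
  free-below (free-common-element (≤-trans (s≤s (+-monoʳ-≤ ∣ S ∣ (∣p∣≤∣x∷p∣ c T))) ∣S∣+∣cT∣<m))
  where free-below : ∃[ x ] x ∉ S × x ∉ T → ∃[ x ] x ∉ inside ∷ S × x ∉ c ∷ T
        free-below (x , x∉S , x∉T) = suc x , x∉S ∘ drop-there , x∉T ∘ drop-there
free-common-element {m = suc m} {S = outside ∷ S} {inside ∷ T} ∣S∣+∣T∣<m
  with free-common-element (≤-pred (subst (_< suc m) (+-suc ∣ S ∣ ∣ T ∣) ∣S∣+∣T∣<m))
... | x , x∉S , x∉T = suc x , x∉S ∘ drop-there , x∉T ∘ drop-there

∁-injective : ∁ S ≡ ∁ T → S ≡ T
∁-injective {S = []} {[]} _ = refl
∁-injective {S = _ ∷ _} {_ ∷ _} eq =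
  cong₂ _∷_ (not-injective (∷-injectiveˡ eq)) (∁-injective (∷-injectiveʳ eq))

lookup-outside⇒∉ : lookup T x ≡ outside → x ∉ T
lookup-outside⇒∉ T[x]≡outside x∈T = contradiction (trans (sym ([]=⇒lookup x∈T)) T[x]≡outside) λ ()

∈-allSubsets : ∀ n (S : Subset n) → S ∈ₗ allSubsets n
∈-allSubsets zero [] = here refl
∈-allSubsets (suc n) (inside ∷ S) = ∈-++⁺ˡ (∈-map⁺ (inside ∷_) (∈-allSubsets n S))
∈-allSubsets (suc n) (outside ∷ S) =
  ∈-++⁺ʳ (map (inside ∷_) (allSubsets n)) (∈-map⁺ (outside ∷_) (∈-allSubsets n S))

allSubsets-unique : ∀ n → Unique (allSubsets n)
allSubsets-unique zero = [] ∷ []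
allSubsets-unique (suc n) =
  Unique.++⁺ (Unique.map⁺ ∷-injectiveʳ (allSubsets-unique n)) (Unique.map⁺ ∷-injectiveʳ (allSubsets-unique n))
             heads-differ
  where
  heads-differ : ∀ {S} → ¬ (S ∈ₗ map (inside ∷_) (allSubsets n) × S ∈ₗ map (outside ∷_) (allSubsets n))
  heads-differ (S∈ , S∈′) with ∈-map⁻ (inside ∷_) S∈ | ∈-map⁻ (outside ∷_) S∈′
  ... | _ , _ , refl | _ , _ , ()

∣insertAt-outside∣ : (S : Subset m) (i : Fin (suc m)) → ∣ insertAt S i outside ∣ ≡ ∣ S ∣
∣insertAt-outside∣ S zero = refl
∣insertAt-outside∣ (inside ∷ S) (suc i) = cong suc (∣insertAt-outside∣ S i)
∣insertAt-outside∣ (outside ∷ S) (suc i) = ∣insertAt-outside∣ S i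

insertAt-intersects⁻ : {S T : Subset m} (i : Fin (suc m)) →
                       Intersects (insertAt S i outside) (insertAt T i outside) → Intersects S T
insertAt-intersects⁻ zero (suc x , there x∈S , there x∈T) = x , x∈S , x∈T
insertAt-intersects⁻ {S = _ ∷ _} {_ ∷ _} (suc i) (zero , here , here) = zero , here , here
insertAt-intersects⁻ {S = _ ∷ _} {_ ∷ _} (suc i) (suc x , there x∈S , there x∈T)
  with insertAt-intersects⁻ i (x , x∈S , x∈T)
... | y , y∈S , y∈T = suc y , there y∈S , there y∈T

insertAt-removeAt-outside : (T : Subset (suc m)) (i : Fin (suc m)) → lookup T i ≡ outside →
                            insertAt (removeAt T i) i outside ≡ T
insertAt-removeAt-outside T i T[i]≡outside =
  subst (λ b → insertAt (removeAt T i) i b ≡ T) T[i]≡outside (insertAt-removeAt T i)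

Family : ℕ → Set
Family m = List (Subset m)

Uniform : ℕ → Family m → Set
Uniform s F = ∀ {S} → S ∈ₗ F → ∣ S ∣ ≡ s

CrossIntersecting : Family m → Family m → Set
CrossIntersecting A B = ∀ {S T} → S ∈ₗ A → T ∈ₗ B → Intersects S T

_∈ₗ?_ : (S : Subset m) (F : Family m) → Dec (S ∈ₗ F)
S ∈ₗ? F = any? (≡-dec Bool._≟_ S) F

record CrossPair (s : ℕ) (A B : Family m) : Set where
  field
    unique-A  : Unique A
    unique-B  : Unique B
    uniform-A : Uniform s A
    uniform-B : Uniform s B
    cross     : CrossIntersecting A B
    member-A  : ∃ (_∈ₗ A)
    member-B  : ∃ (_∈ₗ B)

swap-pair : {A B : Family m} → CrossPair s A B → CrossPair s B A
swap-pair pair = record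
  { unique-A = unique-B ; unique-B = unique-A ; uniform-A = uniform-B ; uniform-B = uniform-A
  ; cross = λ S∈ T∈ → intersects-sym (cross T∈ S∈) ; member-A = member-B ; member-B = member-A }
  where open CrossPair pair

no-empty-pair : {A B : Family m} → ¬ CrossPair 0 A B
no-empty-pair pair = intersects⇒nonzero (cross (proj₂ member-A) (proj₂ member-B)) (uniform-A (proj₂ member-A))
  where open CrossPair pair

-- slice inside F is the link of the first point in F, slice outside F its deletion.
slice : Bool → Family (suc m) → Family m
slice b [] = []
slice b ((c ∷ S) ∷ F) with b Bool.≟ c
... | yes _ = S ∷ slice b F
... | no _ = slice b F

module _ {b : Bool} where

  ∈-slice⁻ : {F : Family (suc m)} → S ∈ₗ slice b F → (b ∷ S) ∈ₗ F
  ∈-slice⁻ {F = (c ∷ T) ∷ F} S∈ with b Bool.≟ c | S∈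
  ... | yes refl | here refl = here refl
  ... | yes refl | there S∈′ = there (∈-slice⁻ S∈′)
  ... | no _     | S∈′       = there (∈-slice⁻ S∈′)

  ∈-slice⁺ : {F : Family (suc m)} → (b ∷ S) ∈ₗ F → S ∈ₗ slice b F
  ∈-slice⁺ {F = (c ∷ T) ∷ F} bS∈ with b Bool.≟ c | bS∈
  ... | yes _   | here eq    = here (∷-injectiveʳ eq)
  ... | yes _   | there bS∈′ = there (∈-slice⁺ bS∈′)
  ... | no b≢c  | here eq    = contradiction (∷-injectiveˡ eq) b≢c
  ... | no _    | there bS∈′ = ∈-slice⁺ bS∈′

  slice-unique : {F : Family (suc m)} → Unique F → Unique (slice b F)
  slice-unique {F = []} [] = []
  slice-unique {F = (c ∷ S) ∷ F} (cS∉F ∷ F!) with b Bool.≟ c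
  ... | yes refl = ¬Any⇒All¬ _ (λ S∈ → All¬⇒¬Any cS∉F (∈-slice⁻ S∈)) ∷ slice-unique F!
  ... | no _ = slice-unique F!

length-slices : (F : Family (suc m)) → length F ≡ length (slice inside F) + length (slice outside F)
length-slices [] = refl
length-slices ((inside ∷ S) ∷ F) = cong suc (length-slices F)
length-slices ((outside ∷ S) ∷ F) =
  trans (cong suc (length-slices F)) (sym (+-suc (length (slice inside F)) _))

uniform-slice-inside : {F : Family (suc m)} → Uniform (suc t) F → Uniform t (slice inside F)
uniform-slice-inside F-uniform S∈ = suc-injective (F-uniform (∈-slice⁻ S∈))

uniform-slice-outside : {F : Family (suc m)} → Uniform t F → Uniform t (slice outside F)
uniform-slice-outside F-uniform S∈ = F-uniform (∈-slice⁻ S∈)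

uniform-length≤C : ∀ m {t} {F : Family m} → Unique F → Uniform t F → length F ≤ m C t
uniform-length≤C zero {zero} {[]} _ _ = z≤n
uniform-length≤C zero {zero} {[] ∷ []} _ _ = ≤-refl
uniform-length≤C zero {zero} {[] ∷ [] ∷ F} ((≢[] ∷ _) ∷ _) _ = contradiction refl ≢[]
uniform-length≤C zero {suc t} {[]} _ _ = z≤n
uniform-length≤C zero {suc t} {[] ∷ F} _ F-uniform = contradiction (F-uniform (here refl)) λ ()
uniform-length≤C (suc m) {zero} {F} F! F-uniform = begin
  length F   ≡⟨ length-slices F ⟩
  ℓ₁ + ℓ₀    ≡⟨ cong (_+ ℓ₀) (length-≡0 λ S∈ → 1+n≢0 (F-uniform (∈-slice⁻ S∈))) ⟩
  ℓ₀         ≤⟨ uniform-length≤C m (slice-unique F!) (uniform-slice-outside F-uniform) ⟩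
  1          ∎
  where
  open ≤-Reasoning
  ℓ₁ = length (slice inside F)
  ℓ₀ = length (slice outside F)
uniform-length≤C (suc m) {suc t} {F} F! F-uniform = begin
  length F            ≡⟨ length-slices F ⟩
  ℓ₁ + ℓ₀             ≤⟨ +-mono-≤ (uniform-length≤C m (slice-unique F!) (uniform-slice-inside F-uniform))
                                  (uniform-length≤C m (slice-unique F!) (uniform-slice-outside F-uniform)) ⟩
  m C t + m C suc t   ≡⟨ nCk+nC[k+1]≡[n+1]C[k+1] m t ⟩
  suc m C suc t       ∎
  where
  open ≤-Reasoning
  ℓ₁ = length (slice inside F)
  ℓ₀ = length (slice outside F)

meeting-length+C≤C : ∀ m {t} (S₀ : Subset m) {F : Family m} → Unique F → Uniform t F →
                     (∀ {S} → S ∈ₗ F → Intersects S S₀) → length F + (m ∸ ∣ S₀ ∣) C t ≤ m C t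
meeting-length+C≤C zero {t} [] {F} _ _ meets-S₀ =
  ≤-reflexive (cong (_+ 0 C t) (length-≡0 λ S∈ → fin0-empty (meets-S₀ S∈)))
  where
  fin0-empty : ∀ {S : Subset 0} → ¬ Intersects S []
  fin0-empty (() , _)
meeting-length+C≤C (suc m) {zero} S₀ {F} _ F-uniform meets-S₀ =
  ≤-reflexive (cong (_+ 1) (length-≡0 λ S∈ → intersects⇒nonzero (meets-S₀ S∈) (F-uniform S∈)))
meeting-length+C≤C (suc m) {suc t} (inside ∷ S₀) {F} F! F-uniform meets-S₀ = begin
  length F + N C suc t         ≡⟨ cong (_+ N C suc t) (length-slices F) ⟩
  (ℓ₁ + ℓ₀) + N C suc t        ≡⟨ +-assoc ℓ₁ ℓ₀ (N C suc t) ⟩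
  ℓ₁ + (ℓ₀ + N C suc t)        ≤⟨ +-mono-≤ (uniform-length≤C m (slice-unique F!) (uniform-slice-inside F-uniform))
                                           (meeting-length+C≤C m S₀ (slice-unique F!) (uniform-slice-outside F-uniform)
                                              (λ S∈ → intersects-dropˡ {c = inside} (meets-S₀ (∈-slice⁻ S∈)))) ⟩
  m C t + m C suc t            ≡⟨ nCk+nC[k+1]≡[n+1]C[k+1] m t ⟩
  suc m C suc t                ∎
  where
  open ≤-Reasoning
  N = m ∸ ∣ S₀ ∣
  ℓ₁ = length (slice inside F)
  ℓ₀ = length (slice outside F)
meeting-length+C≤C (suc m) {suc t} (outside ∷ S₀) {F} F! F-uniform meets-S₀ = begin
  length F + (suc m ∸ ∣ S₀ ∣) C suc t   ≡⟨ cong₂ (λ ℓ n → ℓ + n C suc t) (length-slices F)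
                                                   (+-∸-assoc 1 (∣p∣≤n S₀)) ⟩
  (ℓ₁ + ℓ₀) + suc N C suc t             ≡⟨ cong ((ℓ₁ + ℓ₀) +_) (nCk+nC[k+1]≡[n+1]C[k+1] N t) ⟨
  (ℓ₁ + ℓ₀) + (N C t + N C suc t)       ≤⟨ +-interchange-≤ ℓ₁ ℓ₀ (N C t) (N C suc t)
                                             (meeting-length+C≤C m S₀ (slice-unique F!) (uniform-slice-inside F-uniform)
                                                meets-S₀-below)
                                             (meeting-length+C≤C m S₀ (slice-unique F!) (uniform-slice-outside F-uniform)
                                                meets-S₀-below) ⟩
  m C t + m C suc t                     ≡⟨ nCk+nC[k+1]≡[n+1]C[k+1] m t ⟩
  suc m C suc t                         ∎
  where
  open ≤-Reasoning
  N = m ∸ ∣ S₀ ∣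
  ℓ₁ = length (slice inside F)
  ℓ₀ = length (slice outside F)
  meets-S₀-below : ∀ {b} {S} → S ∈ₗ slice b F → Intersects S S₀
  meets-S₀-below S∈ = intersects-dropʳ (meets-S₀ (∈-slice⁻ S∈))

balanced-cross-length≤C : ∀ s {A B : Family (s + s)} → Unique A → Unique B → Uniform s A → Uniform s B →
                          CrossIntersecting A B → length A + length B ≤ (s + s) C s
balanced-cross-length≤C s {A} {B} A! B! A-uniform B-uniform A×B-meet = begin
  length A + length B             ≡⟨ cong (_+ length B) (length-map ∁ A) ⟨
  length (map ∁ A) + length B     ≡⟨ length-++ (map ∁ A) ⟨
  length (map ∁ A ++ B)           ≤⟨ uniform-length≤C (s + s)
                                       (Unique.++⁺ (Unique.map⁺ ∁-injective A!) B! ∁A-disjoint-B) ∁A++B-uniform ⟩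
  (s + s) C s                     ∎
  where
  open ≤-Reasoning
  ∁A-disjoint-B : ∀ {S} → ¬ (S ∈ₗ map ∁ A × S ∈ₗ B)
  ∁A-disjoint-B (∁T∈ , S∈B) with ∈-map⁻ ∁ ∁T∈
  ... | T , T∈A , refl with A×B-meet T∈A S∈B
  ...   | _ , x∈T , x∈∁T = x∈p⇒x∉∁p x∈T x∈∁T
  ∁A++B-uniform : Uniform s (map ∁ A ++ B)
  ∁A++B-uniform S∈ with ∈-++⁻ (map ∁ A) S∈
  ... | inj₂ S∈B = B-uniform S∈B
  ... | inj₁ S∈∁A with ∈-map⁻ ∁ S∈∁A
  ...   | T , T∈A , refl = trans (∣∁p∣≡n∸∣p∣ T) (trans (cong (s + s ∸_) (A-uniform T∈A)) (m+n∸n≡m s s))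

-- Compression

shift : Fin m → Subset m → Subset (suc m)
shift j S = outside ∷ (j · S)

Settled : Family (suc m) → Fin m → Subset (suc m) → Set
Settled F j (outside ∷ S) = ⊤
Settled F j (inside ∷ S) = j ∉ S → shift j S ∈ₗ F

settled? : (F : Family (suc m)) (j : Fin m) (S : Subset (suc m)) → Dec (Settled F j S)
settled? F j (outside ∷ S) = yes tt
settled? F j (inside ∷ S) = ¬? (j ∈? S) →-dec (shift j S ∈ₗ? F)

Stable : Family (suc m) → Set
Stable F = ∀ j {S} → S ∈ₗ F → Settled F j S

compressSet : Family (suc m) → Fin m → Subset (suc m) → Subset (suc m)
compressSet F j (outside ∷ S) = outside ∷ S
compressSet F j (inside ∷ S) with settled? F j (inside ∷ S)
... | yes _ = inside ∷ S
... | no _ = shift j S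

compress : Family (suc m) → Fin m → Family (suc m)
compress F j = map (compressSet F j) F

data CompressView (F : Family (suc m)) (j : Fin m) : Subset (suc m) → Subset (suc m) → Set where
  kept  : ∀ {S} → Settled F j S → CompressView F j S S
  moved : ∀ {S} → j ∉ S → shift j S ∉ₗ F → CompressView F j (inside ∷ S) (shift j S)

compress-view : ∀ F j (S : Subset (suc m)) → CompressView F j S (compressSet F j S)
compress-view F j (outside ∷ S) = kept tt
compress-view F j (inside ∷ S) with settled? F j (inside ∷ S)
... | yes settled = kept settled
... | no unsettled =
  moved (λ j∈S → unsettled λ j∉S → contradiction j∈S j∉S) (λ shifted∈F → unsettled λ _ → shifted∈F)

compress-unique : {F : Family (suc m)} → Unique F → Unique (compress F j)
compress-unique {j = j} {F = F} = unique-map-on injective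
  where
  injective : ∀ {S T} → S ∈ₗ F → T ∈ₗ F → compressSet F j S ≡ compressSet F j T → S ≡ T
  injective {S} {T} S∈ T∈ eq with compressSet F j S | compress-view F j S | compressSet F j T | compress-view F j T
  ... | _ | kept _ | _ | kept _ = eq
  ... | _ | moved j∉S _ | _ | moved j∉T _ = cong (inside ∷_) (·-injective j∉S j∉T (∷-injectiveʳ eq))
  ... | _ | moved _ shifted∉F | _ | kept _ = contradiction (subst (_∈ₗ F) (sym eq) T∈) shifted∉F
  ... | _ | kept _ | _ | moved _ shifted∉F = contradiction (subst (_∈ₗ F) eq S∈) shifted∉F

compress-uniform : {F : Family (suc m)} → Uniform t F → Uniform t (compress F j)
compress-uniform {j = j} {F = F} F-uniform S′∈ with ∈-map⁻ (compressSet F j) S′∈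
... | S , S∈ , refl with compressSet F j S | compress-view F j S
...   | _ | kept _ = F-uniform S∈
...   | _ | moved j∉S _ = trans (∣·∣ j∉S) (F-uniform S∈)

shift-meets-settled : {B : Family (suc m)} {T : Subset (suc m)} → j ∉ S →
                      (∀ {T′} → T′ ∈ₗ B → Intersects (inside ∷ S) T′) → T ∈ₗ B → Settled B j T →
                      Intersects (shift j S) T
shift-meets-settled {j = j} {T = b ∷ T} j∉S meets-S T∈B settled with j ∈? T
... | yes j∈T = suc j , there ∈-·-self , there j∈T
... | no j∉T with meets-S T∈B
...   | suc x , there x∈S , there x∈T = suc x , there (∈-·⁺ x∈S) , there x∈T
...   | zero , here , here with meets-S (settled j∉T)
...     | suc y , there y∈S , there y∈jT = suc y , there (∈-·⁺ y∈S) , there (∈-·⁻ y∈jT λ { refl → j∉S y∈S })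

compress-cross : {A B : Family (suc m)} → CrossIntersecting A B → CrossIntersecting (compress A j) (compress B j)
compress-cross {j = j} {A = A} {B} A×B-meet S′∈ T′∈
  with ∈-map⁻ (compressSet A j) S′∈ | ∈-map⁻ (compressSet B j) T′∈
... | S , S∈A , refl | T , T∈B , refl
    with compressSet A j S | compress-view A j S | compressSet B j T | compress-view B j T
...   | _ | kept _ | _ | kept _ = A×B-meet S∈A T∈B
...   | _ | moved _ _ | _ | moved _ _ = suc j , there ∈-·-self , there ∈-·-self
...   | _ | moved j∉S _ | _ | kept T-settled = shift-meets-settled j∉S (A×B-meet S∈A) T∈B T-settled
...   | _ | kept S-settled | _ | moved j∉T _ =
  intersects-sym (shift-meets-settled j∉T (λ S′∈A → intersects-sym (A×B-meet S′∈A T∈B)) S∈A S-settled)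

weight : Family (suc m) → ℕ
weight F = length (slice inside F)

compress-weight-≤ : (F G : Family (suc m)) → weight (map (compressSet F j) G) ≤ weight G
compress-weight-≤ F [] = z≤n
compress-weight-≤ F ((outside ∷ S) ∷ G) = compress-weight-≤ F G
compress-weight-≤ {j = j} F ((inside ∷ S) ∷ G) with compressSet F j (inside ∷ S) | compress-view F j (inside ∷ S)
... | _ | kept _ = s≤s (compress-weight-≤ F G)
... | _ | moved _ _ = m≤n⇒m≤1+n (compress-weight-≤ F G)

compress-weight-< : (F G : Family (suc m)) {S : Subset (suc m)} → S ∈ₗ G → ¬ Settled F j S →
                    weight (map (compressSet F j) G) < weight G
compress-weight-< F ((outside ∷ S) ∷ G) (here refl) unsettled = contradiction tt unsettled
compress-weight-< {j = j} F ((inside ∷ S) ∷ G) (here refl) unsettled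
  with compressSet F j (inside ∷ S) | compress-view F j (inside ∷ S)
... | _ | kept settled = contradiction settled unsettled
... | _ | moved _ _ = s≤s (compress-weight-≤ F G)
compress-weight-< F ((outside ∷ S) ∷ G) (there S∈G) unsettled = compress-weight-< F G S∈G unsettled
compress-weight-< {j = j} F ((inside ∷ S) ∷ G) (there S∈G) unsettled
  with compressSet F j (inside ∷ S) | compress-view F j (inside ∷ S)
... | _ | kept _ = s≤s (compress-weight-< F G S∈G unsettled)
... | _ | moved _ _ = m<n⇒m<1+n (compress-weight-< F G S∈G unsettled)

stable-or-unsettled : (F : Family (suc m)) → Stable F ⊎ ∃₂ λ j S → S ∈ₗ F × ¬ Settled F j S
stable-or-unsettled F with any? (λ S → Fin.any? λ j → ¬? (settled? F j S)) F
... | yes some-unsettled with find some-unsettled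
...   | S , S∈F , j , unsettled = inj₂ (j , S , S∈F , unsettled)
stable-or-unsettled F | no none-unsettled =
  inj₁ λ j {S} S∈F → decidable-stable (settled? F j S) λ unsettled → none-unsettled (lose S∈F (j , unsettled))

compress-pair : {A B : Family (suc m)} → CrossPair s A B → CrossPair s (compress A j) (compress B j)
compress-pair {j = j} {A = A} {B} pair = record
  { unique-A  = compress-unique unique-A
  ; unique-B  = compress-unique unique-B
  ; uniform-A = compress-uniform uniform-A
  ; uniform-B = compress-uniform uniform-B
  ; cross     = compress-cross cross
  ; member-A  = _ , ∈-map⁺ (compressSet A j) (proj₂ member-A)
  ; member-B  = _ , ∈-map⁺ (compressSet B j) (proj₂ member-B)
  }
  where open CrossPair pair

-- Terminates because every effective compression lowers the number of members containing the
-- first point.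
stable-suffices : (P : ℕ → ℕ → Set) →
                  (∀ {A B : Family (suc m)} → CrossPair s A B → Stable A → Stable B →
                     P (length A) (length B)) →
                  ∀ {A B : Family (suc m)} → CrossPair s A B → P (length A) (length B)
stable-suffices {m = m} {s = s} P P-stable pair = go _ _ pair (<-wellFounded _)
  where
  go : (A B : Family (suc m)) → CrossPair s A B → Acc _<_ (weight A + weight B) → P (length A) (length B)
  go A B pair (acc smaller) with stable-or-unsettled A | stable-or-unsettled B
  ... | inj₁ A-stable | inj₁ B-stable = P-stable pair A-stable B-stable
  ... | inj₂ (j , S , S∈A , unsettled) | _ =
    subst₂ P (length-map _ A) (length-map _ B)
      (go (compress A j) (compress B j) (compress-pair pair)
          (smaller (+-mono-<-≤ (compress-weight-< A A S∈A unsettled) (compress-weight-≤ B B))))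
  ... | inj₁ _ | inj₂ (j , T , T∈B , unsettled) =
    subst₂ P (length-map _ A) (length-map _ B)
      (go (compress A j) (compress B j) (compress-pair pair)
          (smaller (+-mono-≤-< (compress-weight-≤ A A) (compress-weight-< B B T∈B unsettled))))

-- Cross-intersecting families

deletion-member : {F : Family (suc m)} → Stable F → Uniform (suc t) F → t < m →
                  ∃ (_∈ₗ F) → ∃ (_∈ₗ slice outside F)
deletion-member _ _ _ (outside ∷ S , S∈F) = S , ∈-slice⁺ S∈F
deletion-member F-stable F-uniform t<m (inside ∷ S , S∈F)
  with free-element (subst (_< _) (sym (suc-injective (F-uniform S∈F))) t<m)
... | j , j∉S = j · S , ∈-slice⁺ (F-stable j S∈F j∉S)

link-cross : {A B : Family (suc m)} → Stable A → CrossIntersecting A B →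
             Uniform t (slice inside A) → Uniform t (slice inside B) → t + t < m →
             CrossIntersecting (slice inside A) (slice inside B)
link-cross A-stable A×B-meet A₁-uniform B₁-uniform t+t<m {S} {T} S∈ T∈
  with free-common-element {S = S} {T}
         (subst₂ (λ a b → a + b < _) (sym (A₁-uniform S∈)) (sym (B₁-uniform T∈)) t+t<m)
... | y , y∉S , y∉T with A×B-meet (A-stable y (∈-slice⁻ S∈) y∉S) (∈-slice⁻ T∈)
...   | suc x , there x∈yS , there x∈T = x , ∈-·⁻ x∈yS (λ { refl → y∉T x∈T }) , x∈T

deletion-pair : {A B : Family (suc m)} → Stable A → Stable B → t < m → CrossPair (suc t) A B →
                CrossPair (suc t) (slice outside A) (slice outside B)
deletion-pair A-stable B-stable t<m pair = record
  { unique-A = slice-unique unique-A ; unique-B = slice-unique unique-B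
  ; uniform-A = uniform-slice-outside uniform-A ; uniform-B = uniform-slice-outside uniform-B
  ; cross = λ S∈ T∈ → intersects-dropˡ (cross (∈-slice⁻ S∈) (∈-slice⁻ T∈))
  ; member-A = deletion-member A-stable uniform-A t<m member-A
  ; member-B = deletion-member B-stable uniform-B t<m member-B }
  where open CrossPair pair

link-pair : {A B : Family (suc m)} → Stable A → t + t < m → CrossPair (suc t) A B →
            ∃ (_∈ₗ slice inside A) → ∃ (_∈ₗ slice inside B) → CrossPair t (slice inside A) (slice inside B)
link-pair A-stable t+t<m pair S∈ T∈ = record
  { unique-A = slice-unique unique-A ; unique-B = slice-unique unique-B
  ; uniform-A = uniform-slice-inside uniform-A ; uniform-B = uniform-slice-inside uniform-B
  ; cross = link-cross A-stable cross (uniform-slice-inside uniform-A) (uniform-slice-inside uniform-B) t+t<m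
  ; member-A = S∈ ; member-B = T∈ }
  where open CrossPair pair

HiltonMilnerBound : ℕ → Set
HiltonMilnerBound m = ∀ {s} {A B : Family m} → s + s ≤ m → CrossPair s A B →
                      length A + length B + (m ∸ s) C s ≤ m C s + 1

balanced-hilton-milner : ∀ s {A B : Family (s + s)} → CrossPair s A B →
                         length A + length B + (s + s ∸ s) C s ≤ (s + s) C s + 1
balanced-hilton-milner s {A} {B} pair = begin
  length A + length B + (s + s ∸ s) C s  ≡⟨ cong (λ n → length A + length B + n C s) (m+n∸n≡m s s) ⟩
  length A + length B + s C s            ≡⟨ cong (length A + length B +_) (nCn≡1 s) ⟩
  length A + length B + 1                ≤⟨ +-monoˡ-≤ 1 (balanced-cross-length≤C s unique-A unique-B
                                                                              uniform-A uniform-B cross) ⟩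
  (s + s) C s + 1                        ∎
  where
  open ≤-Reasoning
  open CrossPair pair

link-length+C≤C : {A B : Family (suc m)} → t < m → CrossPair (suc t) A B → Stable A →
                  length (slice inside B) + (m ∸ suc t) C t ≤ m C t
link-length+C≤C {m = m} {t = t} {B = B} t<m pair A-stable =
  subst (λ k → length (slice inside B) + (m ∸ k) C t ≤ m C t) (uniform-slice-outside uniform-A a₀∈)
        (meeting-length+C≤C m a₀ (slice-unique unique-B) (uniform-slice-inside uniform-B)
           λ T∈ → intersects-sym (intersects-dropˡ (cross (∈-slice⁻ a₀∈) (∈-slice⁻ T∈))))
  where
  open CrossPair pair
  a₀-member = deletion-member A-stable uniform-A t<m member-A
  a₀ = proj₁ a₀-member
  a₀∈ = proj₂ a₀-member

nonempty-links-length+C≤C : {A B : Family (suc m)} → HiltonMilnerBound m → suc t + suc t ≤ m →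
                            CrossPair (suc t) A B → Stable A → ∃ (_∈ₗ slice inside A) → ∃ (_∈ₗ slice inside B) →
                            length (slice inside A) + length (slice inside B) + (m ∸ suc t) C t ≤ m C t
nonempty-links-length+C≤C {t = zero} hm 2≤m pair A-stable A₁∋ B₁∋ =
  contradiction (link-pair A-stable ([1+t]+[1+t]≤m⇒t+t<m 0 2≤m) pair A₁∋ B₁∋) no-empty-pair
nonempty-links-length+C≤C {m = m} {t = suc t} {A = A} {B} hm 2t+4≤m pair A-stable A₁∋ B₁∋ =
  ℓ+[a+b]≤c+1⇒ℓ+b≤c (A₁ + B₁) (N C t) (N C suc t) (m C suc t) (k≤n⇒0<nCk t≤N)
    (subst (λ k → A₁ + B₁ + k ≤ m C suc t + 1) [m∸1+t]C[1+t]≡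
       (hm (<⇒≤ 2t+2<m) (link-pair A-stable 2t+2<m pair A₁∋ B₁∋)))
  where
  A₁ = length (slice inside A)
  B₁ = length (slice inside B)
  N = m ∸ suc (suc t)
  2t+2<m : suc t + suc t < m
  2t+2<m = [1+t]+[1+t]≤m⇒t+t<m (suc t) 2t+4≤m
  t≤N : t ≤ N
  t≤N = m+n≤o⇒m≤o∸n t (≤-trans (+-monoˡ-≤ (suc (suc t)) (≤-trans (n≤1+n t) (n≤1+n (suc t)))) 2t+4≤m)
  [m∸1+t]C[1+t]≡ : (m ∸ suc t) C suc t ≡ N C t + N C suc t
  [m∸1+t]C[1+t]≡ = trans (cong (_C suc t) (+-∸-assoc 1 ([1+t]+[1+t]≤m⇒t<m (suc t) 2t+4≤m)))
                         (sym (nCk+nC[k+1]≡[n+1]C[k+1] N t))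

links-length+C≤C : {A B : Family (suc m)} → HiltonMilnerBound m → suc t + suc t ≤ m →
                   CrossPair (suc t) A B → Stable A → Stable B →
                   length (slice inside A) + length (slice inside B) + (m ∸ suc t) C t ≤ m C t
links-length+C≤C {m = m} {t = t} {A} {B} hm 2t+2≤m pair A-stable B-stable
  with empty-or-member (slice inside A) | empty-or-member (slice inside B)
... | inj₁ A₁≡[] | _ =
  subst (λ ℓ → ℓ + length (slice inside B) + (m ∸ suc t) C t ≤ m C t) (sym (cong length A₁≡[]))
        (link-length+C≤C ([1+t]+[1+t]≤m⇒t<m t 2t+2≤m) pair A-stable)
... | inj₂ _ | inj₁ B₁≡[] =
  subst (λ ℓ → ℓ + (m ∸ suc t) C t ≤ m C t)
        (trans (sym (+-identityʳ _)) (cong (length (slice inside A) +_) (sym (cong length B₁≡[]))))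
        (link-length+C≤C ([1+t]+[1+t]≤m⇒t<m t 2t+2≤m) (swap-pair pair) B-stable)
... | inj₂ A₁∋ | inj₂ B₁∋ = nonempty-links-length+C≤C hm 2t+2≤m pair A-stable A₁∋ B₁∋

stable-hilton-milner-step : {A B : Family (suc m)} → HiltonMilnerBound m → suc t + suc t ≤ m →
                            CrossPair (suc t) A B → Stable A → Stable B →
                            length A + length B + (suc m ∸ suc t) C suc t ≤ suc m C suc t + 1
stable-hilton-milner-step {m = m} {t = t} {A} {B} hm 2t+2≤m pair A-stable B-stable = begin
  length A + length B + (m ∸ t) C suc t
    ≡⟨ cong₂ (λ a b → a + b + (m ∸ t) C suc t) (length-slices A) (length-slices B) ⟩
  (A₁ + A₀) + (B₁ + B₀) + (m ∸ t) C suc t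
    ≡⟨ cong (λ n → (A₁ + A₀) + (B₁ + B₀) + n C suc t) (+-∸-assoc 1 t<m) ⟩
  (A₁ + A₀) + (B₁ + B₀) + suc N C suc t
    ≡⟨ cong ((A₁ + A₀) + (B₁ + B₀) +_) (nCk+nC[k+1]≡[n+1]C[k+1] N t) ⟨
  (A₁ + A₀) + (B₁ + B₀) + (N C t + N C suc t)
    ≡⟨ +-interchange₃ A₁ A₀ B₁ B₀ (N C t) (N C suc t) ⟩
  (A₁ + B₁ + N C t) + (A₀ + B₀ + N C suc t)
    ≤⟨ +-mono-≤ (links-length+C≤C hm 2t+2≤m pair A-stable B-stable)
                (hm 2t+2≤m (deletion-pair A-stable B-stable t<m pair)) ⟩
  m C t + (m C suc t + 1)
    ≡⟨ +-assoc (m C t) (m C suc t) 1 ⟨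
  m C t + m C suc t + 1
    ≡⟨ cong (_+ 1) (nCk+nC[k+1]≡[n+1]C[k+1] m t) ⟩
  suc m C suc t + 1 ∎
  where
  open ≤-Reasoning
  t<m = [1+t]+[1+t]≤m⇒t<m t 2t+2≤m
  N = m ∸ suc t
  A₁ = length (slice inside A)
  A₀ = length (slice outside A)
  B₁ = length (slice inside B)
  B₀ = length (slice outside B)

hilton-milner : ∀ m → HiltonMilnerBound m
hilton-milner m {zero} _ pair = contradiction pair no-empty-pair
hilton-milner zero {suc t} () _
hilton-milner (suc m) {suc t} 2s≤m+1 pair with suc t + suc t ≟ suc m
... | yes refl = balanced-hilton-milner (suc t) pair
... | no 2s≢m+1 =
  stable-suffices (λ a b → a + b + (suc m ∸ suc t) C suc t ≤ suc m C suc t + 1)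
                  (stable-hilton-milner-step (hilton-milner m) (≤-pred (≤∧≢⇒< 2s≤m+1 2s≢m+1))) pair

-- Otherwise the members with and without P would be nonempty cross-intersecting families
-- exceeding the Hilton–Milner bound.
disjoint-spreading⇒universal : s + s ≤ m → {F : Family m} → Unique F → Uniform s F →
                               {P : Subset m → Set} (P? : (S : Subset m) → Dec (P S)) →
                               (∀ {S T} → S ∈ₗ F → T ∈ₗ F → ¬ Intersects S T → P S → P T) →
                               m C s ∸ (m ∸ s) C s + 1 < length F →
                               ∃[ S₀ ] S₀ ∈ₗ F × P S₀ → ∀ {T} → T ∈ₗ F → P T
disjoint-spreading⇒universal {s = s} {m = m} 2s≤m {F} F! F-uniform P? P-spreads large (S₀ , S₀∈F , PS₀) {T} T∈F
  with P? T
... | yes PT = PT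
... | no ¬PT = contradiction (subst (λ ℓ → ℓ + (m ∸ s) C s ≤ m C s + 1) (sym (length-partition P? F))
                                    (hilton-milner m 2s≤m pair))
                             (y∸x+1<ℓ⇒ℓ+x≰y+1 large)
  where
  ¬P? = λ S → ¬? (P? S)
  pair : CrossPair s (filter P? F) (filter ¬P? F)
  pair = record
    { unique-A = Unique.filter⁺ P? F! ; unique-B = Unique.filter⁺ ¬P? F!
    ; uniform-A = λ S∈ → F-uniform (proj₁ (∈-filter⁻ P? S∈))
    ; uniform-B = λ S∈ → F-uniform (proj₁ (∈-filter⁻ ¬P? S∈))
    ; cross = λ {S} {S′} S∈ S′∈ → let (S∈F , PS) = ∈-filter⁻ P? S∈ ; (S′∈F , ¬PS′) = ∈-filter⁻ ¬P? S′∈ in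
        decidable-stable (intersects? S S′) λ disjoint → ¬PS′ (P-spreads S∈F S′∈F disjoint PS)
    ; member-A = S₀ , ∈-filter⁺ P? S₀∈F PS₀
    ; member-B = T , ∈-filter⁺ ¬P? T∈F ¬PT }

-- Common neighbourhoods

module Avoiding {m : ℕ} {u v : Fin (suc (suc m))} (u≢v : u ≢ v) where

  v′ : Fin (suc m)
  v′ = punchOut u≢v

  strip : Subset (suc (suc m)) → Subset m
  strip T = removeAt (removeAt T u) v′

  embed : Subset m → Subset (suc (suc m))
  embed S = insertAt (insertAt S v′ outside) u outside

  embed-strip : {T : Subset (suc (suc m))} → lookup T u ≡ outside → lookup T v ≡ outside →
                embed (strip T) ≡ T
  embed-strip {T} T[u]≡outside T[v]≡outside = begin
    insertAt (insertAt (removeAt (removeAt T u) v′) v′ outside) u outside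
      ≡⟨ cong (λ T′ → insertAt T′ u outside)
              (insertAt-removeAt-outside (removeAt T u) v′ (trans (removeAt-punchOut T u≢v) T[v]≡outside)) ⟩
    insertAt (removeAt T u) u outside
      ≡⟨ insertAt-removeAt-outside T u T[u]≡outside ⟩
    T ∎
    where open ≡-Reasoning

  ∣embed∣ : (S : Subset m) → ∣ embed S ∣ ≡ ∣ S ∣
  ∣embed∣ S = trans (∣insertAt-outside∣ (insertAt S v′ outside) u) (∣insertAt-outside∣ S v′)

  embed-intersects⁻ : {S T : Subset m} → Intersects (embed S) (embed T) → Intersects S T
  embed-intersects⁻ = insertAt-intersects⁻ v′ ∘ insertAt-intersects⁻ u

module _ {n k : ℕ} (H : KGraph n (suc k)) where

  InN⇒outside : InN H x T → lookup T x ≡ outside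
  InN⇒outside {x = x} {T} x∈N = not-injective (∧-conicalˡ (not (lookup T x)) _ x∈N)

  InN⇒size : InN H x T → ∣ T ∣ ≡ k
  InN⇒size {x = x} {T} x∈N =
    suc-injective (trans (sym (∣·∣ {j = x} {S = T} (lookup-outside⇒∉ (InN⇒outside x∈N))))
                         (uniform H (x · T) (∧-conicalʳ _ _ x∈N)))

module CommonNeighbourhood {m k : ℕ} (H : KGraph (suc (suc m)) (suc k))
                           {u v : Fin (suc (suc m))} (u≢v : u ≢ v) where

  open Avoiding u≢v public

  in-common? : (T : Subset (suc (suc m))) → Dec (inNᵇ H u T ∧ inNᵇ H v T ≡ true)
  in-common? T = inNᵇ H u T ∧ inNᵇ H v T Bool.≟ true

  -- The filter of commonSize, so that length-family needs no counting argument.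
  common : Family (suc (suc m))
  common = filter in-common? (allSubsets (suc (suc m)))

  ∈-common⁺ : InCommon H u v T → T ∈ₗ common
  ∈-common⁺ {T = T} (u∈N , v∈N) = ∈-filter⁺ in-common? (∈-allSubsets _ T) (cong₂ _∧_ u∈N v∈N)

  ∈-common⁻ : T ∈ₗ common → InCommon H u v T
  ∈-common⁻ {T = T} T∈ =
    ∧-conicalˡ (inNᵇ H u T) (inNᵇ H v T) both , ∧-conicalʳ (inNᵇ H u T) (inNᵇ H v T) both
    where both = proj₂ (∈-filter⁻ in-common? {xs = allSubsets (suc (suc m))} T∈)

  embed-strip-common : InCommon H u v T → embed (strip T) ≡ T
  embed-strip-common (u∈N , v∈N) = embed-strip (InN⇒outside H u∈N) (InN⇒outside H v∈N)

  family : Family m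
  family = map strip common

  length-family : length family ≡ commonSize H u v
  length-family = length-map strip common

  family-unique : Unique family
  family-unique = unique-map-on strip-injective (Unique.filter⁺ _ (allSubsets-unique _))
    where
    strip-injective : ∀ {T T′} → T ∈ₗ common → T′ ∈ₗ common → strip T ≡ strip T′ → T ≡ T′
    strip-injective {T} {T′} T∈ T′∈ eq = begin
      T                ≡⟨ embed-strip-common (∈-common⁻ T∈) ⟨
      embed (strip T)  ≡⟨ cong embed eq ⟩
      embed (strip T′) ≡⟨ embed-strip-common (∈-common⁻ T′∈) ⟩
      T′               ∎
      where open ≡-Reasoning

  ∈-family⁺ : InCommon H u v T → strip T ∈ₗ family
  ∈-family⁺ T∈N = ∈-map⁺ strip (∈-common⁺ T∈N)

  ∈-family⁻ : S ∈ₗ family → InCommon H u v (embed S)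
  ∈-family⁻ S∈ with ∈-map⁻ strip S∈
  ... | T , T∈ , refl = subst (InCommon H u v) (sym (embed-strip-common (∈-common⁻ T∈))) (∈-common⁻ T∈)

  family-uniform : Uniform k family
  family-uniform {S} S∈ = trans (sym (∣embed∣ S)) (InN⇒size H (proj₁ (∈-family⁻ S∈)))

-- Colour patterns

SamePattern : ∀ {r} → Fin r × Fin r → Fin r × Fin r → Set
SamePattern (a , b) (a′ , b′) = (a ≡ b × a′ ≡ b′) ⊎ (a ≡ a′ × b ≡ b′)

module _ {r : ℕ} where

  samePattern? : (p q : Fin r × Fin r) → Dec (SamePattern p q)
  samePattern? (a , b) (a′ , b′) = (a Fin.≟ b ×-dec a′ Fin.≟ b′) ⊎-dec (a Fin.≟ a′ ×-dec b Fin.≟ b′)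

  samePattern-sym : {p q : Fin r × Fin r} → SamePattern p q → SamePattern q p
  samePattern-sym (inj₁ (a≡b , a′≡b′)) = inj₁ (a′≡b′ , a≡b)
  samePattern-sym (inj₂ (a≡a′ , b≡b′)) = inj₂ (sym a≡a′ , sym b≡b′)

  samePattern-trans : {p q o : Fin r × Fin r} → SamePattern p q → SamePattern q o → SamePattern p o
  samePattern-trans (inj₁ (a≡b , _)) (inj₁ (_ , a″≡b″)) = inj₁ (a≡b , a″≡b″)
  samePattern-trans (inj₁ (a≡b , a′≡b′)) (inj₂ (a′≡a″ , b′≡b″)) =
    inj₁ (a≡b , trans (sym a′≡a″) (trans a′≡b′ b′≡b″))
  samePattern-trans (inj₂ (a≡a′ , b≡b′)) (inj₁ (a′≡b′ , a″≡b″)) =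
    inj₁ (trans a≡a′ (trans a′≡b′ (sym b≡b′)) , a″≡b″)
  samePattern-trans (inj₂ (a≡a′ , b≡b′)) (inj₂ (a′≡a″ , b′≡b″)) =
    inj₂ (trans a≡a′ a′≡a″ , trans b≡b′ b′≡b″)

  δ : Fin r → Fin r → ℕ
  δ a i = if does (a Fin.≟ i) then 1 else 0

  δ-self : (a : Fin r) → δ a a ≡ 1
  δ-self a with a Fin.≟ a
  ... | yes _ = refl
  ... | no a≢a = contradiction refl a≢a

  δ-≢ : {a i : Fin r} → a ≢ i → δ a i ≡ 0
  δ-≢ {a} {i} a≢i with a Fin.≟ i
  ... | yes a≡i = contradiction a≡i a≢i
  ... | no _ = refl

  δ-positive : {a i : Fin r} → 0 < δ a i → a ≡ i
  δ-positive {a} {i} 0<δ with a Fin.≟ i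
  ... | yes a≡i = a≡i
  δ-positive () | no _

  δ-injective : {a b : Fin r} → (∀ i → δ a i ≡ δ b i) → a ≡ b
  δ-injective {a} {b} δa≗δb = sym (δ-positive (subst (0 <_) (δa≗δb a) (≤-reflexive (sym (δ-self a)))))

  δ-pair-injective : {a b a′ b′ : Fin r} → (∀ i → δ a i + δ b i ≡ δ a′ i + δ b′ i) →
                     (a ≡ a′ × b ≡ b′) ⊎ (a ≡ b′ × b ≡ a′)
  δ-pair-injective {a} {b} {a′} {b′} same with a′ Fin.≟ a
  ... | yes refl = inj₁ (refl , δ-injective λ i → +-cancelˡ-≡ (δ a i) _ _ (same i))
  ... | no a′≢a = inj₂ (sym b′≡a , δ-injective λ i → +-cancelʳ-≡ (δ a i) (δ b i) (δ a′ i) (begin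
      δ b i + δ a i    ≡⟨ +-comm (δ b i) (δ a i) ⟩
      δ a i + δ b i    ≡⟨ same i ⟩
      δ a′ i + δ b′ i  ≡⟨ cong (λ x → δ a′ i + δ x i) b′≡a ⟩
      δ a′ i + δ a i   ∎))
    where
    open ≡-Reasoning
    b′≡a : b′ ≡ a
    b′≡a = δ-positive (subst (0 <_) 1+δba≡δb′a (s≤s z≤n))
      where
      1+δba≡δb′a : 1 + δ b a ≡ δ b′ a
      1+δba≡δb′a = trans (cong (_+ δ b a) (sym (δ-self a))) (trans (same a) (cong (_+ δ b′ a) (δ-≢ a′≢a)))

  profile-∷ : ∀ {n} (c : Subset n → Fin r) e es i → profile c (e ∷ es) i ≡ δ (c e) i + profile c es i
  profile-∷ c e es i with c e Fin.≟ i
  ... | yes _ = refl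
  ... | no _ = refl

  profile-pair : ∀ {n} (c : Subset n → Fin r) e f i → profile c (e ∷ f ∷ []) i ≡ δ (c e) i + δ (c f) i
  profile-pair c e f i =
    trans (profile-∷ c e _ i) (cong (δ (c e) i +_) (trans (profile-∷ c f [] i) (+-identityʳ (δ (c f) i))))

colours : ∀ {n r} → (Subset n → Fin r) → Fin n → Fin n → Subset n → Fin r × Fin r
colours c u v T = c (u · T) , c (v · T)

module _ {n k r : ℕ} {H : KGraph n k} {c : Subset n → Fin r} (no-gadget : ¬ GoodGadget1 H c)
         {u v : Fin n} (u≢v : u ≢ v) {S T : Subset n} (S∈N : InCommon H u v S) (T∈N : InCommon H u v T)
         (S∩T≡∅ : Disjoint S T) where

  no-gadget⇒equal-δ : ∀ i → δ (c (u · S)) i + δ (c (v · T)) i ≡ δ (c (v · S)) i + δ (c (u · T)) i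
  no-gadget⇒equal-δ i = begin
    δ (c (u · S)) i + δ (c (v · T)) i                ≡⟨ profile-pair c (u · S) (v · T) i ⟨
    profile c ((u · S) ∷ (v · T) ∷ []) i             ≡⟨ equal-profiles i ⟩
    profile c ((v · S) ∷ (u · T) ∷ []) i             ≡⟨ profile-pair c (v · S) (u · T) i ⟩
    δ (c (v · S)) i + δ (c (u · T)) i                ∎
    where
    open ≡-Reasoning
    equal-profiles : ∀ i → profile c ((u · S) ∷ (v · T) ∷ []) i ≡ profile c ((v · S) ∷ (u · T) ∷ []) i
    equal-profiles = decidable-stable
                       (Fin.all? λ i → profile c ((u · S) ∷ (v · T) ∷ []) i ≟ profile c ((v · S) ∷ (u · T) ∷ []) i)
                       λ differ → no-gadget (u , v , S , T , u≢v , S∈N , T∈N , S∩T≡∅ , differ)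

  disjoint⇒samePattern : SamePattern (colours c u v S) (colours c u v T)
  disjoint⇒samePattern = Sum.map (Product.map₂ sym) (Product.map₂ sym) (δ-pair-injective no-gadget⇒equal-δ)

samePattern-conclusion : ∀ {n r} {c : Subset n → Fin r} {u v : Fin n} {P : Subset n → Set} {T₀ : Subset n} →
  (∀ {T} → P T → SamePattern (colours c u v T) (colours c u v T₀)) →
  (∀ T → P T → c (u · T) ≡ c (v · T))
  ⊎ Σ (Fin r) (λ i → Σ (Fin r) (λ j → i ≢ j × (∀ T → P T → c (u · T) ≡ i × c (v · T) ≡ j)))
samePattern-conclusion {c = c} {u} {v} {T₀ = T₀} like-T₀ with c (u · T₀) Fin.≟ c (v · T₀)
... | yes a₀≡b₀ = inj₁ λ T PT → monochromatic (like-T₀ PT)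
  where
  monochromatic : ∀ {a b} → SamePattern (a , b) (c (u · T₀) , c (v · T₀)) → a ≡ b
  monochromatic (inj₁ (a≡b , _)) = a≡b
  monochromatic (inj₂ (a≡a₀ , b≡b₀)) = trans a≡a₀ (trans a₀≡b₀ (sym b≡b₀))
... | no a₀≢b₀ = inj₂ (c (u · T₀) , c (v · T₀) , a₀≢b₀ , λ T PT → same-pair (like-T₀ PT))
  where
  same-pair : ∀ {a b} → SamePattern (a , b) (c (u · T₀) , c (v · T₀)) → a ≡ c (u · T₀) × b ≡ c (v · T₀)
  same-pair (inj₁ (_ , a₀≡b₀)) = contradiction a₀≡b₀ a₀≢b₀
  same-pair (inj₂ a≡a₀×b≡b₀) = a≡a₀×b≡b₀

large-common-neighbourhood : ∀ {m k r} (H : KGraph (suc (suc m)) (suc k)) (c : Subset (suc (suc m)) → Fin r) →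
  ¬ GoodGadget1 H c → k + k ≤ m → {u v : Fin (suc (suc m))} → u ≢ v →
  m C k ∸ (m ∸ k) C k + 1 < commonSize H u v →
  ∃[ T₀ ] ∀ {T} → InCommon H u v T → SamePattern (colours c u v T) (colours c u v T₀)
large-common-neighbourhood {m} {k} H c no-gadget 2k≤m {u} {v} u≢v large =
  embed S₀ , λ T∈N →
    subst (λ T → SamePattern (colours c u v T) _) (embed-strip-common T∈N) (all-like-S₀ (∈-family⁺ T∈N))
  where
  open CommonNeighbourhood H u≢v
  large-family : m C k ∸ (m ∸ k) C k + 1 < length family
  large-family = subst (_ <_) (sym length-family) large
  S₀-member = member-of-length (<-≤-trans (s≤s z≤n) large-family)
  S₀ = proj₁ S₀-member
  LikeS₀ : Subset m → Set
  LikeS₀ S = SamePattern (colours c u v (embed S)) (colours c u v (embed S₀))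
  spreads : ∀ {S S′} → S ∈ₗ family → S′ ∈ₗ family → ¬ Intersects S S′ → LikeS₀ S → LikeS₀ S′
  spreads S∈ S′∈ S∩S′≡∅ like =
    samePattern-trans (samePattern-sym (disjoint⇒samePattern {H = H} {c = c} no-gadget u≢v
                                          (∈-family⁻ S∈) (∈-family⁻ S′∈)
                                          (¬intersects⇒disjoint (S∩S′≡∅ ∘ embed-intersects⁻)))) like
  all-like-S₀ : ∀ {S} → S ∈ₗ family → LikeS₀ S
  all-like-S₀ = disjoint-spreading⇒universal 2k≤m family-unique family-uniform (λ S → samePattern? _ _) spreads
                  large-family (S₀ , proj₂ S₀-member , inj₂ (refl , refl))

lemma3p2 : (n k r : ℕ) → 1 ≤ k → n > 2 * k → 2 ≤ r →
    (H : KGraph n k) → (c : Subset n → Fin r) → NoGoodGadget H c →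
    (u v : Fin n) → u ≢ v →
    commonSize H u v > ((n ∸ 2) C (k ∸ 1)) ∸ (((n ∸ 2) ∸ (k ∸ 1)) C (k ∸ 1)) + 1 →
    (∀ T → InCommon H u v T → c (u · T) ≡ c (v · T))
    ⊎ Σ (Fin r) (λ i → Σ (Fin r) (λ j → i ≢ j ×
        (∀ T → InCommon H u v T → c (u · T) ≡ i × c (v · T) ≡ j)))
lemma3p2 n zero r () _ _ H c _ u v _ _
lemma3p2 zero (suc k) r _ () _ H c _ u v _ _
lemma3p2 (suc zero) (suc k) r _ (s≤s ()) _ H c _ u v _ _
lemma3p2 (suc (suc m)) (suc k) r _ 2k<n _ H c (no-gadget₁ , _) u v u≢v large =
  samePattern-conclusion {c = c}
    (proj₂ (large-common-neighbourhood H c no-gadget₁ (2[1+k]<2+m⇒k+k≤m k m 2k<n) u≢v large))
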